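{- Let $r\ge 1$, $n=2^r-1$, and let $\mathcal{C}\subseteq \mathbb{F}_2^{n+1}$ be an extended 1-perfect code of length $n+1$ with kernel $K=\mathrm{Ker}(\mathcal{C})$. Then $\mathcal{C}$ is foldable over every linear subspace $L\subseteq K$; that is, for every linear subspace $L\subseteq K$ and all $u,v\in\mathcal{C}$ with $d(u,v)=4$, for every $u'\in (u+L)\cap\mathcal{C}$ there exists $v'\in (v+L)\cap\mathcal{C}$ with $d(u',v')=4$ and $s(u'v')=s(uv)$.
   Context: Words of $\mathbb{F}_2^{n+1}$ have coordinates indexed by $\{0,1,\dots,n\}$, and $d$ denotes Hamming distance. A 1-perfect code of length $n=2^r-1$ is a set $C\subseteq\mathbb{F}_2^n$ such that every word of $\mathbb{F}_2^n\setminus C$ is at Hamming distance $1$ from exactly one word of $C$ and no two words of $C$ are at distance $1$; an extended 1-perfect code of length $n+1$ is obtained from such a $C$ by appending an overall parity-check coordinate. The kernel $\mathrm{Ker}(\mathcal{C})$ is the set of all $x\in\mathbb{F}_2^{n+1}$ with $x+\mathcal{C}=\mathcal{C}$ (a linear subspace). For $v,w\in\mathcal{C}$ with $d(v,w)=4$, $s(vw)$ denotes the set of the four coordinate indices in which $v$ and $w$ differ. The classes of $\mathcal{C}$ modulo $L$ are the sets $v+L$, $v\in\mathcal{C}$. -}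

module Defs where

open import Data.Bool using (Bool; true; false; _xor_)
open import Data.Nat using (ℕ; zero; suc; _+_)
open import Data.Vec using (Vec; []; _∷_; _∷ʳ_; zipWith; replicate; foldr)
open import Data.Product using (Σ; _×_; _,_)
open import Relation.Binary.PropositionalEquality using (_≡_; _≢_)
open import Relation.Nullary using (¬_)

-- Words of F_2^m: vectors of booleans (true = 1); coordinate i is position i.
Word : ℕ → Set
Word m = Vec Bool m

Code : ℕ → Set₁
Code m = Word m → Set

_⊕_ : ∀ {m} → Word m → Word m → Word m
_⊕_ = zipWith _xor_

infixl 6 _⊕_

𝟎 : ∀ {m} → Word m
𝟎 = replicate _ false

wt : ∀ {m} → Word m → ℕ
wt [] = 0
wt (true ∷ x) = suc (wt x)
wt (false ∷ x) = wt x

d : ∀ {m} → Word m → Word m → ℕ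
d u v = wt (u ⊕ v)

-- s(uv): the set of coordinates where u and v differ, as its indicator vector
-- (a subset of {0,…,m-1}).
s : ∀ {m} → Word m → Word m → Vec Bool m
s u v = u ⊕ v

parity : ∀ {m} → Word m → Bool
parity = foldr _ _xor_ false

Is1Perfect : (n : ℕ) → Code n → Set
Is1Perfect n C =
  (∀ (x : Word n) → ¬ C x →
     Σ (Word n) λ c → C c × d x c ≡ 1 × (∀ c' → C c' → d x c' ≡ 1 → c' ≡ c))
  × (∀ (c c' : Word n) → C c → C c' → d c c' ≢ 1)

IsExtensionOf : (n : ℕ) → Code (suc n) → Code n → Set
IsExtensionOf n 𝒞 C =
  (∀ (x : Word (suc n)) → 𝒞 x → Σ (Word n) λ c → C c × x ≡ c ∷ʳ parity c)
  × (∀ (c : Word n) → C c → 𝒞 (c ∷ʳ parity c))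

IsExtended1Perfect : (n : ℕ) → Code (suc n) → Set₁
IsExtended1Perfect n 𝒞 = Σ (Code n) λ C → Is1Perfect n C × IsExtensionOf n 𝒞 C

InKernel : ∀ {m} → Code m → Word m → Set
InKernel 𝒞 x =
  (∀ c → 𝒞 c → 𝒞 (x ⊕ c))
  × (∀ c → 𝒞 c → Σ (Word _) λ c' → 𝒞 c' × c ≡ x ⊕ c')

-- Linear subspace of F_2^m (over F_2: contains 0 and closed under addition).
IsSubspace : ∀ {m} → (Word m → Set) → Set
IsSubspace L = L 𝟎 × (∀ x y → L x → L y → L (x ⊕ y))

InCoset : ∀ {m} → Word m → (Word m → Set) → Word m → Set
InCoset v L w = Σ (Word _) λ l → L l × w ≡ v ⊕ l

module Submission where

-- The argument uses nothing about perfectness: it holds for every binary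
-- code 𝒞 and every set L of kernel words.  Given u, v ∈ 𝒞 and
-- u' = u + l ∈ (u + L) ∩ 𝒞, take v' = v + l.  Since l lies in the kernel,
-- v' ∈ 𝒞, and v' ∈ v + L by construction.  Translating both words by the
-- same vector l does not change their sum, (u + l) + (v + l) = u + v, so
-- s(u'v') = s(uv) and d(u',v') = d(u,v) = 4.

open import Defs
open import Data.Bool.Properties using (xor-comm; xor-assoc; xor-same)
open import Data.Nat using (ℕ; suc; _^_; _∸_; _≥_)
open import Data.Product using (Σ; _×_; _,_; proj₁)
open import Data.Vec using ([]; _∷_)
open import Relation.Binary.PropositionalEquality
  using (_≡_; refl; cong; cong₂; sym; module ≡-Reasoning)
open ≡-Reasoning

⊕-comm : ∀ {m} (x y : Word m) → x ⊕ y ≡ y ⊕ x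
⊕-comm []      []      = refl
⊕-comm (a ∷ x) (b ∷ y) = cong₂ _∷_ (xor-comm a b) (⊕-comm x y)

⊕-assoc : ∀ {m} (x y z : Word m) → (x ⊕ y) ⊕ z ≡ x ⊕ (y ⊕ z)
⊕-assoc []      []      []      = refl
⊕-assoc (a ∷ x) (b ∷ y) (c ∷ z) = cong₂ _∷_ (xor-assoc a b c) (⊕-assoc x y z)

⊕-self : ∀ {m} (x : Word m) → x ⊕ x ≡ 𝟎
⊕-self []      = refl
⊕-self (a ∷ x) = cong₂ _∷_ (xor-same a) (⊕-self x)

⊕-identityˡ : ∀ {m} (x : Word m) → 𝟎 ⊕ x ≡ x
⊕-identityˡ []      = refl
⊕-identityˡ (a ∷ x) = cong (a ∷_) (⊕-identityˡ x)

⊕-translate : ∀ {m} (u v l : Word m) → (u ⊕ l) ⊕ (v ⊕ l) ≡ u ⊕ v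
⊕-translate u v l = begin
  (u ⊕ l) ⊕ (v ⊕ l)  ≡⟨ cong ((u ⊕ l) ⊕_) (⊕-comm v l) ⟩
  (u ⊕ l) ⊕ (l ⊕ v)  ≡⟨ ⊕-assoc u l (l ⊕ v) ⟩
  u ⊕ (l ⊕ (l ⊕ v))  ≡⟨ cong (u ⊕_) (sym (⊕-assoc l l v)) ⟩
  u ⊕ ((l ⊕ l) ⊕ v)  ≡⟨ cong (λ w → u ⊕ (w ⊕ v)) (⊕-self l) ⟩
  u ⊕ (𝟎 ⊕ v)        ≡⟨ cong (u ⊕_) (⊕-identityˡ v) ⟩
  u ⊕ v              ∎

s-translate : ∀ {m} (u v l : Word m) → s (u ⊕ l) (v ⊕ l) ≡ s u v
s-translate = ⊕-translate

d-translate : ∀ {m} (u v l : Word m) → d (u ⊕ l) (v ⊕ l) ≡ d u v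
d-translate u v l = cong wt (⊕-translate u v l)

FoldableOver : ∀ {m} → Code m → (Word m → Set) → Set
FoldableOver {m} 𝒞 L =
  (u v : Word m) → 𝒞 u → 𝒞 v → d u v ≡ 4 →
  (u' : Word m) → InCoset u L u' → 𝒞 u' →
  Σ (Word m) λ v' → InCoset v L v' × 𝒞 v' × d u' v' ≡ 4 × s u' v' ≡ s u v

-- Any code is foldable over any set of its kernel words: translate v by the
-- same kernel vector l that carries u to u'.
foldable-over-kernel : ∀ {m} (𝒞 : Code m) (L : Word m → Set) →
  (∀ x → L x → InKernel 𝒞 x) → FoldableOver 𝒞 L
foldable-over-kernel 𝒞 L L⊆Ker u v _ 𝒞v duv .(u ⊕ l) (l , Ll , refl) _ =
  v ⊕ l , (l , Ll , refl) , v⊕l∈𝒞 , d≡4 , s-translate u v l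
  where
  v⊕l∈𝒞 : 𝒞 (v ⊕ l)
  v⊕l∈𝒞 rewrite ⊕-comm v l = proj₁ (L⊆Ker l Ll) v 𝒞v

  d≡4 : d (u ⊕ l) (v ⊕ l) ≡ 4
  d≡4 = begin
    d (u ⊕ l) (v ⊕ l)  ≡⟨ d-translate u v l ⟩
    d u v              ≡⟨ duv ⟩
    4                  ∎

proposition3 : (r : ℕ) → r ≥ 1 →
    (𝒞 : Code (suc (2 ^ r ∸ 1))) → IsExtended1Perfect (2 ^ r ∸ 1) 𝒞 →
    (L : Word (suc (2 ^ r ∸ 1)) → Set) → IsSubspace L → (∀ x → L x → InKernel 𝒞 x) →
    (u v : Word (suc (2 ^ r ∸ 1))) → 𝒞 u → 𝒞 v → d u v ≡ 4 →
    (u' : Word (suc (2 ^ r ∸ 1))) → InCoset u L u' → 𝒞 u' →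
    Σ (Word (suc (2 ^ r ∸ 1))) λ v' →
    InCoset v L v' × 𝒞 v' × d u' v' ≡ 4 × s u' v' ≡ s u v
proposition3 r _ 𝒞 _ L _ L⊆Ker = foldable-over-kernel 𝒞 L L⊆Ker
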